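{- Let $(g(n))_{n\ge1}$ be any sequence of complex numbers. Then there exist sequences $(P(n))_{n\ge0}$ with $P(0)=1$, $(b_n)_{n\ge1}$, and numbers $F_k(n)$ ($n\ge1$, $1\le k\le n$) such that for all $n\ge1$: $$\sum_{k=1}^nkF_k(n)=nP(n),\qquad iF_i(n)=\sum_{j=1}^n a'_i(j)P(n-j)\ (1\le i\le n),\ \text{ where } a'_i(j)=\begin{cases}ib_i,& j=ri \text{ for some integer } r\ge 1,\\0,&\text{otherwise},\end{cases}$$ and $$nP(n)=\sum_{k=1}^ng(k)P(n-k).$$ Moreover, the sequences $b_n$, $P(n)$ and $F_k(n)$ are uniquely determined by these conditions. -}

module Defs where

open import Level using (_⊔_)
open import Data.Nat using (ℕ; zero; suc; _∸_; _≤_)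
open import Data.Nat.Divisibility using (_∣?_)
open import Data.Bool using (if_then_else_)
open import Data.Product using (Σ; _×_; ∃)
open import Relation.Nullary using (does)
open import Algebra.Bundles using (CommutativeRing)

module _ {c ℓ} (R : CommutativeRing c ℓ) where
  open CommutativeRing R

  _·_ : ℕ → Carrier → Carrier
  zero  · x = 0#
  suc n · x = x + (n · x)

  Σ1to : ℕ → (ℕ → Carrier) → Carrier
  Σ1to zero    f = 0#
  Σ1to (suc n) f = Σ1to n f + f (suc n)

  -- every positive integer is invertible in R (true for ℂ, or any field of char 0)
  PositiveIntegersInvertible : Set (c ⊔ ℓ)
  PositiveIntegersInvertible = ∀ n → ∃ λ y → (suc n · 1#) * y ≈ 1#

  -- a'_i(j) = i b_i if j = r i for some integer r ≥ 1, and 0 otherwise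
  -- (for i, j ≥ 1 this is exactly the condition  i ∣ j)
  a′ : (ℕ → Carrier) → ℕ → ℕ → Carrier
  a′ b i j = if does (i ∣? j) then i · b i else 0#

  -- the defining conditions of Theorem 4.3 for data (g, P, b, F);
  -- F k n is only meaningful for 1 ≤ k ≤ n, b n and g n for n ≥ 1
  Conditions : (g P b : ℕ → Carrier) (F : ℕ → ℕ → Carrier) → Set ℓ
  Conditions g P b F =
      (P 0 ≈ 1#)
    × (∀ n → 1 ≤ n → Σ1to n (λ k → k · F k n) ≈ n · P n)
    × (∀ n i → 1 ≤ i → i ≤ n → i · F i n ≈ Σ1to n (λ j → a′ b i j * P (n ∸ j)))
    × (∀ n → 1 ≤ n → n · P n ≈ Σ1to n (λ k → g k * P (n ∸ k)))

{-# OPTIONS --safe #-}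
module Submission where

-- Summing the condition on F over i turns ∑ k F_k(n) into the convolution
-- ∑_j D(j) P(n − j) of P with the divisor sums D(j) = ∑_{k ∣ j} k b_k.  As P(0) = 1,
-- such a convolution determines its left factor, so the conditions say exactly that
-- n P(n) = ∑ g(k) P(n − k), that ∑_{k ∣ n} k b_k = g(n), and that i F_i(n) is given by
-- its defining sum.  Each of these is a triangular system whose diagonal coefficients
-- are positive integers, hence has exactly one solution when those are invertible.

open import Defs using (PositiveIntegersInvertible; Conditions)
import Defs
open import Data.Nat using (ℕ; zero; suc; _≤_; _<_; _∸_; z≤n; s≤s; _≤?_)
open import Data.Nat.Properties using (m≤n⇒m≤1+n; ≤-refl; m∸n≤m; n∸n≡0; ≰⇒>; m≤n⇒m<n∨m≡n; <⇒≱; ≤-antisym; n≮n)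
open import Data.Nat.Divisibility using (_∣?_; ∣⇒≤; ∣-refl)
open import Data.Nat.Induction using (<-rec)
open import Data.Product using (Σ; _×_; _,_; proj₁; proj₂)
open import Data.Sum using (inj₁; inj₂)
open import Data.Bool using (true; false; if_then_else_)
open import Relation.Nullary using (yes; no; does; contradiction)
open import Relation.Nullary.Decidable using (dec-true; dec-false)
import Relation.Binary.PropositionalEquality as ≡
open import Algebra.Bundles using (CommutativeRing)
import Algebra.Properties.CommutativeSemigroup as CommutativeSemigroupProperties
import Algebra.Properties.Group as GroupProperties
import Relation.Binary.Reasoning.Setoid as SetoidReasoning

module _ {c ℓ} (R : CommutativeRing c ℓ) where
  open CommutativeRing R hiding (zero)
  open CommutativeSemigroupProperties +-commutativeSemigroup using (interchange)
  open GroupProperties +-group using (∙-cancelˡ; \\-leftDividesˡ)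
  open SetoidReasoning setoid

  _·_ : ℕ → Carrier → Carrier
  _·_ = Defs._·_ R

  Σ1to : ℕ → (ℕ → Carrier) → Carrier
  Σ1to = Defs.Σ1to R

  a′ : (ℕ → Carrier) → ℕ → ℕ → Carrier
  a′ = Defs.a′ R

  ·-cong : ∀ n {x y} → x ≈ y → n · x ≈ n · y
  ·-cong zero    _   = refl
  ·-cong (suc n) x≈y = +-cong x≈y (·-cong n x≈y)

  ·≈* : ∀ n x → n · x ≈ (n · 1#) * x
  ·≈* zero    x = sym (zeroˡ x)
  ·≈* (suc n) x = begin
    x + n · x                 ≈⟨ +-cong (sym (*-identityˡ x)) (·≈* n x) ⟩
    1# * x + (n · 1#) * x     ≈⟨ distribʳ x 1# (n · 1#) ⟨
    (1# + n · 1#) * x         ∎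

  Σ1to-cong : ∀ n {f h : ℕ → Carrier} → (∀ k → 1 ≤ k → k ≤ n → f k ≈ h k) → Σ1to n f ≈ Σ1to n h
  Σ1to-cong zero    _   = refl
  Σ1to-cong (suc n) f≈h = +-cong (Σ1to-cong n (λ k 1≤k k≤n → f≈h k 1≤k (m≤n⇒m≤1+n k≤n)))
                                 (f≈h (suc n) (s≤s z≤n) ≤-refl)

  Σ1to-zero : ∀ n → Σ1to n (λ _ → 0#) ≈ 0#
  Σ1to-zero zero    = refl
  Σ1to-zero (suc n) = trans (+-identityʳ _) (Σ1to-zero n)

  Σ1to-distrib-+ : ∀ n (f h : ℕ → Carrier) → Σ1to n (λ k → f k + h k) ≈ Σ1to n f + Σ1to n h
  Σ1to-distrib-+ zero    f h = sym (+-identityˡ 0#)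
  Σ1to-distrib-+ (suc n) f h = trans (+-congʳ (Σ1to-distrib-+ n f h)) (interchange _ _ _ _)

  Σ1to-distribʳ : ∀ n (f : ℕ → Carrier) x → Σ1to n f * x ≈ Σ1to n (λ k → f k * x)
  Σ1to-distribʳ zero    f x = zeroˡ x
  Σ1to-distribʳ (suc n) f x = trans (distribʳ x _ _) (+-congʳ (Σ1to-distribʳ n f x))

  Σ1to-comm : ∀ m n (f : ℕ → ℕ → Carrier) →
              Σ1to m (λ i → Σ1to n (f i)) ≈ Σ1to n (λ j → Σ1to m (λ i → f i j))
  Σ1to-comm zero    n f = sym (Σ1to-zero n)
  Σ1to-comm (suc m) n f = trans (+-congʳ (Σ1to-comm m n f)) (sym (Σ1to-distrib-+ n _ _))

  Σ1to-truncate : ∀ {m n} (f : ℕ → Carrier) → m ≤ n → (∀ k → m < k → k ≤ n → f k ≈ 0#) →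
                  Σ1to n f ≈ Σ1to m f
  Σ1to-truncate {m} {n} f m≤n f≈0 with m≤n⇒m<n∨m≡n m≤n
  ... | inj₂ ≡.refl = refl
  Σ1to-truncate {m} {suc n} f _ f≈0 | inj₁ (s≤s m≤n) = begin
    Σ1to n f + f (suc n) ≈⟨ +-cong (Σ1to-truncate f m≤n (λ k m<k k≤n → f≈0 k m<k (m≤n⇒m≤1+n k≤n)))
                                   (f≈0 (suc n) (s≤s m≤n) ≤-refl) ⟩
    Σ1to m f + 0#        ≈⟨ +-identityʳ _ ⟩
    Σ1to m f             ∎

  a′-diag : ∀ b j → a′ b j j ≈ j · b j
  a′-diag b j = reflexive (≡.cong (if_then j · b j else 0#) (dec-true (j ∣? j) ∣-refl))

  a′-vanishes-below : ∀ b {k j} → 1 ≤ j → j < k → a′ b k j ≈ 0#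
  a′-vanishes-below b {k} {suc j} _ j<k =
    reflexive (≡.cong (if_then k · b k else 0#) (dec-false (k ∣? suc j) (λ k∣j → <⇒≱ j<k (∣⇒≤ k∣j))))

  a′-cong : ∀ {b b′} k j → b k ≈ b′ k → a′ b k j ≈ a′ b′ k j
  a′-cong k j bk≈b′k with does (k ∣? j)
  ... | true  = ·-cong k bk≈b′k
  ... | false = refl

  divisorSum : (ℕ → Carrier) → ℕ → Carrier
  divisorSum b n = Σ1to n (λ k → a′ b k n)

  divisorSum-suc : ∀ b n → divisorSum b (suc n) ≈ Σ1to n (λ k → a′ b k (suc n)) + suc n · b (suc n)
  divisorSum-suc b n = +-congˡ (a′-diag b (suc n))

  infixl 7 _⋆_
  _⋆_ : (ℕ → Carrier) → (ℕ → Carrier) → ℕ → Carrier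
  (u ⋆ P) n = Σ1to n (λ j → u j * P (n ∸ j))

  ⋆-congˡ : ∀ {u v} P n → (∀ j → 1 ≤ j → j ≤ n → u j ≈ v j) → (u ⋆ P) n ≈ (v ⋆ P) n
  ⋆-congˡ P n u≈v = Σ1to-cong n (λ j 1≤j j≤n → *-congʳ (u≈v j 1≤j j≤n))

  ⋆-congʳ : ∀ {P P′} u n → (∀ {m} → m < n → P m ≈ P′ m) → (u ⋆ P) n ≈ (u ⋆ P′) n
  ⋆-congʳ u zero    _    = refl
  ⋆-congʳ u (suc n) P≈P′ = Σ1to-cong (suc n) λ { (suc j) _ _ → *-congˡ (P≈P′ (s≤s (m∸n≤m n j))) }

  ⋆-cancelʳ : ∀ {P u v} → P 0 ≈ 1# → (∀ n → 1 ≤ n → (u ⋆ P) n ≈ (v ⋆ P) n) →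
              ∀ n → 1 ≤ n → u n ≈ v n
  ⋆-cancelʳ {P} {u} {v} P0≈1 u⋆P≈v⋆P = <-rec _ step
    where
    *P[n∸n] : ∀ x n → x * P (n ∸ n) ≈ x
    *P[n∸n] x n = trans (*-congˡ (trans (reflexive (≡.cong P (n∸n≡0 n))) P0≈1)) (*-identityʳ x)

    step : ∀ n → (∀ {m} → m < n → 1 ≤ m → u m ≈ v m) → 1 ≤ n → u n ≈ v n
    step (suc n) u≈v _ = begin
      u (suc n)                ≈⟨ *P[n∸n] (u (suc n)) n ⟨
      u (suc n) * P (n ∸ n)    ≈⟨ ∙-cancelˡ _ _ _ (trans (+-congʳ earlier) (u⋆P≈v⋆P (suc n) (s≤s z≤n))) ⟩
      v (suc n) * P (n ∸ n)    ≈⟨ *P[n∸n] (v (suc n)) n ⟩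
      v (suc n)                ∎
      where
      earlier : Σ1to n (λ j → v j * P (suc n ∸ j)) ≈ Σ1to n (λ j → u j * P (suc n ∸ j))
      earlier = Σ1to-cong n (λ j 1≤j j≤n → *-congʳ (sym (u≈v (s≤s j≤n) 1≤j)))

  ΣkF≈divisorSum⋆P : ∀ {P b} (F : ℕ → ℕ → Carrier) n →
                     (∀ i → 1 ≤ i → i ≤ n → i · F i n ≈ (a′ b i ⋆ P) n) →
                     Σ1to n (λ k → k · F k n) ≈ (divisorSum b ⋆ P) n
  ΣkF≈divisorSum⋆P {P} {b} F n iF = begin
    Σ1to n (λ k → k · F k n)                              ≈⟨ Σ1to-cong n iF ⟩
    Σ1to n (λ i → Σ1to n (λ j → a′ b i j * P (n ∸ j)))    ≈⟨ Σ1to-comm n n _ ⟩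
    Σ1to n (λ j → Σ1to n (λ i → a′ b i j * P (n ∸ j)))    ≈⟨ Σ1to-cong n (λ j _ _ → Σ1to-distribʳ n _ _) ⟨
    Σ1to n (λ j → Σ1to n (λ i → a′ b i j) * P (n ∸ j))    ≈⟨ ⋆-congˡ P n divisors ⟩
    (divisorSum b ⋆ P) n                                  ∎
    where
    divisors : ∀ j → 1 ≤ j → j ≤ n → Σ1to n (λ i → a′ b i j) ≈ divisorSum b j
    divisors j 1≤j j≤n = Σ1to-truncate _ j≤n (λ i j<i _ → a′-vanishes-below b 1≤j j<i)

  Conditions⇒divisorSum≈g : ∀ {g P b F} → Conditions R g P b F → ∀ n → 1 ≤ n → divisorSum b n ≈ g n
  Conditions⇒divisorSum≈g {g} {P} {b} {F} (P0≈1 , kF , iF , nP) =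
    ⋆-cancelʳ {P} P0≈1 λ n 1≤n → begin
      (divisorSum b ⋆ P) n       ≈⟨ ΣkF≈divisorSum⋆P {P} F n (iF n) ⟨
      Σ1to n (λ k → k · F k n)   ≈⟨ kF n 1≤n ⟩
      n · P n                    ≈⟨ nP n 1≤n ⟩
      (g ⋆ P) n                  ∎

  module CourseOfValues (step : ℕ → (ℕ → Carrier) → Carrier)
                        (step-cong : ∀ n {h h′} → (∀ {k} → k < n → h k ≈ h′ k) → step n h ≈ step n h′)
                        where
    -- table n k = fix k for k ≤ n; by step-cong the filler 0# used above n is never read.
    table : ℕ → ℕ → Carrier
    table zero    _ = step zero (λ _ → 0#)
    table (suc n) k with k ≤? n
    ... | yes _ = table n k
    ... | no  _ = step (suc n) (table n)

    fix : ℕ → Carrier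
    fix n = table n n

    fix-suc : ∀ n → fix (suc n) ≈ step (suc n) (table n)
    fix-suc n with suc n ≤? n
    ... | yes n<n = contradiction n<n (n≮n n)
    ... | no  _   = refl

    table-fix : ∀ n {k} → k ≤ n → table n k ≈ fix k
    table-fix zero    {zero} _ = refl
    table-fix (suc n) {k} k≤1+n with k ≤? n
    ... | yes k≤n = table-fix n k≤n
    ... | no  k≰n with ≡.refl ← ≤-antisym k≤1+n (≰⇒> k≰n) = sym (fix-suc n)

    fix-unfold : ∀ n → fix n ≈ step n fix
    fix-unfold zero    = step-cong zero λ ()
    fix-unfold (suc n) = trans (fix-suc n) (step-cong (suc n) λ { (s≤s k≤n) → table-fix n k≤n })

  module _ (invertible : PositiveIntegersInvertible R) where
    1/[1+_] : ℕ → Carrier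
    1/[1+ n ] = proj₁ (invertible n)

    ·-divide : ∀ n x → suc n · (1/[1+ n ] * x) ≈ x
    ·-divide n x = begin
      suc n · (1/[1+ n ] * x)           ≈⟨ ·≈* (suc n) _ ⟩
      (suc n · 1#) * (1/[1+ n ] * x)    ≈⟨ *-assoc _ _ _ ⟨
      ((suc n · 1#) * 1/[1+ n ]) * x    ≈⟨ *-congʳ (proj₂ (invertible n)) ⟩
      1# * x                            ≈⟨ *-identityˡ x ⟩
      x                                 ∎

    divide-· : ∀ n x → 1/[1+ n ] * (suc n · x) ≈ x
    divide-· n x = begin
      1/[1+ n ] * (suc n · x)           ≈⟨ *-congˡ (·≈* (suc n) x) ⟩
      1/[1+ n ] * ((suc n · 1#) * x)    ≈⟨ *-assoc _ _ _ ⟨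
      (1/[1+ n ] * (suc n · 1#)) * x    ≈⟨ *-congʳ (trans (*-comm _ _) (proj₂ (invertible n))) ⟩
      1# * x                            ≈⟨ *-identityˡ x ⟩
      x                                 ∎

    ·-cancel : ∀ n {x y} → suc n · x ≈ suc n · y → x ≈ y
    ·-cancel n {x} {y} nx≈ny = trans (sym (divide-· n x)) (trans (*-congˡ nx≈ny) (divide-· n y))

    divisorSum-injective : ∀ {b b′} → (∀ n → 1 ≤ n → divisorSum b n ≈ divisorSum b′ n) →
                           ∀ n → 1 ≤ n → b n ≈ b′ n
    divisorSum-injective {b} {b′} Db≈Db′ = <-rec _ step
      where
      step : ∀ n → (∀ {m} → m < n → 1 ≤ m → b m ≈ b′ m) → 1 ≤ n → b n ≈ b′ n
      step (suc n) b≈b′ _ = ·-cancel n (∙-cancelˡ _ _ _ (begin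
        Σ1to n (λ k → a′ b k (suc n)) + suc n · b (suc n)      ≈⟨ divisorSum-suc b n ⟨
        divisorSum b (suc n)                                   ≈⟨ Db≈Db′ (suc n) (s≤s z≤n) ⟩
        divisorSum b′ (suc n)                                  ≈⟨ divisorSum-suc b′ n ⟩
        Σ1to n (λ k → a′ b′ k (suc n)) + suc n · b′ (suc n)    ≈⟨ +-congʳ earlier ⟨
        Σ1to n (λ k → a′ b k (suc n)) + suc n · b′ (suc n)     ∎))
        where
        earlier : Σ1to n (λ k → a′ b k (suc n)) ≈ Σ1to n (λ k → a′ b′ k (suc n))
        earlier = Σ1to-cong n (λ k 1≤k k≤n → a′-cong {b} {b′} k (suc n) (b≈b′ (s≤s k≤n) 1≤k))

    recurrence-unique : ∀ {g P P′} → P 0 ≈ 1# → P′ 0 ≈ 1# →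
                        (∀ n → 1 ≤ n → n · P n ≈ (g ⋆ P) n) → (∀ n → 1 ≤ n → n · P′ n ≈ (g ⋆ P′) n) →
                        ∀ n → P n ≈ P′ n
    recurrence-unique {g} {P} {P′} P0≈1 P′0≈1 nP nP′ = <-rec _ step
      where
      step : ∀ n → (∀ {m} → m < n → P m ≈ P′ m) → P n ≈ P′ n
      step zero    _    = trans P0≈1 (sym P′0≈1)
      step (suc n) P≈P′ = ·-cancel n (begin
        suc n · P (suc n)     ≈⟨ nP (suc n) (s≤s z≤n) ⟩
        (g ⋆ P) (suc n)       ≈⟨ ⋆-congʳ g (suc n) P≈P′ ⟩
        (g ⋆ P′) (suc n)      ≈⟨ nP′ (suc n) (s≤s z≤n) ⟨
        suc n · P′ (suc n)    ∎)

    module Uniqueness {g P b F} (C : Conditions R g P b F) {P′ b′ F′} (C′ : Conditions R g P′ b′ F′) where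
      P-unique : ∀ n → P n ≈ P′ n
      P-unique =
        let (P0≈1 , _ , _ , nP) = C; (P′0≈1 , _ , _ , nP′) = C′
        in  recurrence-unique P0≈1 P′0≈1 nP nP′

      b-unique : ∀ n → 1 ≤ n → b n ≈ b′ n
      b-unique = divisorSum-injective λ n 1≤n →
        trans (Conditions⇒divisorSum≈g C n 1≤n) (sym (Conditions⇒divisorSum≈g C′ n 1≤n))

      F-unique : ∀ n k → 1 ≤ k → k ≤ n → F k n ≈ F′ k n
      F-unique n (suc k) 1≤k k≤n =
        let (_ , _ , iF , _) = C; (_ , _ , iF′ , _) = C′
        in  ·-cancel k (begin
        suc k · F (suc k) n          ≈⟨ iF n (suc k) 1≤k k≤n ⟩
        (a′ b (suc k) ⋆ P) n         ≈⟨ ⋆-congˡ P n (λ j _ _ → a′-cong {b} {b′} (suc k) j (b-unique (suc k) 1≤k)) ⟩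
        (a′ b′ (suc k) ⋆ P) n        ≈⟨ ⋆-congʳ (a′ b′ (suc k)) n (λ {m} _ → P-unique m) ⟩
        (a′ b′ (suc k) ⋆ P′) n       ≈⟨ iF′ n (suc k) 1≤k k≤n ⟨
        suc k · F′ (suc k) n         ∎)

    module Solution (g : ℕ → Carrier) where
      P-step : ℕ → (ℕ → Carrier) → Carrier
      P-step zero    _ = 1#
      P-step (suc n) P = 1/[1+ n ] * (g ⋆ P) (suc n)

      P-step-cong : ∀ n {h h′} → (∀ {k} → k < n → h k ≈ h′ k) → P-step n h ≈ P-step n h′
      P-step-cong zero    _    = refl
      P-step-cong (suc n) h≈h′ = *-congˡ (⋆-congʳ g (suc n) h≈h′)

      -- b (suc n) is solved from divisorSum b (suc n) ≈ g (suc n), where it has coefficient suc n.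
      b-step : ℕ → (ℕ → Carrier) → Carrier
      b-step zero    _ = 0#
      b-step (suc n) b = 1/[1+ n ] * (- Σ1to n (λ k → a′ b k (suc n)) + g (suc n))

      b-step-cong : ∀ n {h h′} → (∀ {k} → k < n → h k ≈ h′ k) → b-step n h ≈ b-step n h′
      b-step-cong zero    _    = refl
      b-step-cong (suc n) {h} {h′} h≈h′ = *-congˡ (+-congʳ (-‿cong
        (Σ1to-cong n (λ k _ k≤n → a′-cong {h} {h′} k (suc n) (h≈h′ (s≤s k≤n))))))

      module P-recursion = CourseOfValues P-step P-step-cong
      module b-recursion = CourseOfValues b-step b-step-cong

      P : ℕ → Carrier
      P = P-recursion.fix

      b : ℕ → Carrier
      b = b-recursion.fix

      F : ℕ → ℕ → Carrier
      F zero    _ = 0#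
      F (suc i) n = 1/[1+ i ] * (a′ b (suc i) ⋆ P) n

      P-zero : P 0 ≈ 1#
      P-zero = P-recursion.fix-unfold 0

      P-recurrence : ∀ n → 1 ≤ n → n · P n ≈ (g ⋆ P) n
      P-recurrence (suc n) _ = trans (·-cong (suc n) (P-recursion.fix-unfold (suc n))) (·-divide n _)

      divisorSum-b : ∀ n → 1 ≤ n → divisorSum b n ≈ g n
      divisorSum-b (suc n) _ = begin
        divisorSum b (suc n)          ≈⟨ divisorSum-suc b n ⟩
        S + suc n · b (suc n)         ≈⟨ +-congˡ (·-cong (suc n) (b-recursion.fix-unfold (suc n))) ⟩
        S + suc n · b-step (suc n) b  ≈⟨ +-congˡ (·-divide n _) ⟩
        S + (- S + g (suc n))         ≈⟨ \\-leftDividesˡ S (g (suc n)) ⟩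
        g (suc n)                     ∎
        where
        S = Σ1to n (λ k → a′ b k (suc n))

      F-formula : ∀ n i → 1 ≤ i → i ≤ n → i · F i n ≈ (a′ b i ⋆ P) n
      F-formula n (suc i) _ _ = ·-divide i _

      ΣkF≈nP : ∀ n → 1 ≤ n → Σ1to n (λ k → k · F k n) ≈ n · P n
      ΣkF≈nP n 1≤n = begin
        Σ1to n (λ k → k · F k n)   ≈⟨ ΣkF≈divisorSum⋆P {P} F n (F-formula n) ⟩
        (divisorSum b ⋆ P) n       ≈⟨ ⋆-congˡ P n (λ j 1≤j _ → divisorSum-b j 1≤j) ⟩
        (g ⋆ P) n                  ≈⟨ P-recurrence n 1≤n ⟨
        n · P n                    ∎

      conditions : Conditions R g P b F
      conditions = P-zero , ΣkF≈nP , F-formula , P-recurrence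

theorem4p3 : ∀ {c ℓ} (R : CommutativeRing c ℓ) → PositiveIntegersInvertible R →
    let open CommutativeRing R in
    (g : ℕ → Carrier) →
    Σ (ℕ → Carrier) λ P → Σ (ℕ → Carrier) λ b → Σ (ℕ → ℕ → Carrier) λ F →
      Conditions R g P b F
      × ((P′ b′ : ℕ → Carrier) (F′ : ℕ → ℕ → Carrier) → Conditions R g P′ b′ F′ →
           (∀ n → P n ≈ P′ n)
           × (∀ n → 1 ≤ n → b n ≈ b′ n)
           × (∀ n k → 1 ≤ k → k ≤ n → F k n ≈ F′ k n))
theorem4p3 R invertible g =
  P , b , F , conditions , λ _ _ _ C′ → let open Uniqueness R invertible conditions C′ in
    P-unique , b-unique , F-unique
  where open Solution R invertible g
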